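{- Let $G$ be the weighted complete graph $K_4$ on vertices $x_1, x_2, x_3, x_4$ in which the edges $x_1x_2$ and $x_3x_4$ have weight $2$ and every other edge has weight $5$. Then, starting from $13$ pebbles all placed on any single vertex, one can reach a distribution with at least one pebble on every vertex; however, starting from the distribution with $9$ pebbles on $x_1$ and $4$ pebbles on $x_2$ (also $13$ pebbles in total), no sequence of pebbling moves yields a distribution with at least one pebble on every vertex. Consequently, for weighted graphs the weighted cover pebbling number $\gamma(G)$ is not in general equal to the minimum number $N$ such that placing $N$ pebbles on any single vertex allows every vertex to be covered.
   Context: A weighted graph is a graph $G$ together with a function $w: E(G) \to \mathbb{N}^+$. A distribution is a function $D: V(G)\to\mathbb{N}$ (numbers of pebbles). A pebbling move along an edge $e = xx'$ removes $w(e)$ pebbles from $x$ and places one pebble on $x'$. A distribution $D'$ is reachable from $D$ if a sequence of pebbling moves leads from $D$ to a distribution $D''$ with $D''(v)\ge D'(v)$ for all $v$. The cover pebbling number $\gamma(G)$ is the smallest number $N$ such that the all-ones distribution (one pebble on every vertex) is reachable from every distribution with at least $N$ pebbles. -}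

module Defs where

open import Data.Nat using (ℕ; zero; suc; _+_; _∸_; _≤_)
open import Data.Fin using (Fin; zero; suc; _≟_)
open import Data.Product using (Σ; ∃; ∃₂; _×_; _,_)
open import Data.Empty using (⊥)
open import Relation.Nullary using (¬_; yes; no)
open import Relation.Binary.PropositionalEquality using (_≡_; _≢_)
open import Relation.Binary.Construct.Closure.ReflexiveTransitive using (Star)

Dist : ℕ → Set
Dist n = Fin n → ℕ

total : ∀ {n} → Dist n → ℕ
total {zero}  D = 0
total {suc n} D = D zero + total (λ i → D (suc i))

-- A weighted graph on vertex set Fin n: a symmetric adjacency relation
-- and a weight function (only its values on edges matter).
record WGraph (n : ℕ) : Set₁ where
  field
    Adj    : Fin n → Fin n → Set
    weight : Fin n → Fin n → ℕ

open WGraph public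

Step : ∀ {n} → WGraph n → Dist n → Dist n → Set
Step {n} G D D′ =
  ∃₂ λ (x y : Fin n) →
      Adj G x y
    × weight G x y ≤ D x
    × D′ x ≡ D x ∸ weight G x y
    × D′ y ≡ D y + 1
    × (∀ v → v ≢ x → v ≢ y → D′ v ≡ D v)

Reachable : ∀ {n} → WGraph n → Dist n → Dist n → Set
Reachable {n} G D D′ = ∃ λ (D″ : Dist n) → Star (Step G) D D″ × (∀ v → D′ v ≤ D″ v)

ones : ∀ {n} → Dist n
ones _ = 1

single : ∀ {n} → Fin n → ℕ → Dist n
single v N u with v ≟ u
... | yes _ = N
... | no  _ = 0

CoverGood : ∀ {n} → WGraph n → ℕ → Set
CoverGood G N = ∀ D → N ≤ total D → Reachable G D ones

IsCoverPebblingNumber : ∀ {n} → WGraph n → ℕ → Set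
IsCoverPebblingNumber G N = CoverGood G N × (∀ M → CoverGood G M → N ≤ M)

SingleGood : ∀ {n} → WGraph n → ℕ → Set
SingleGood G N = ∀ v → Reachable G (single v N) ones

IsSingleVertexCoverNumber : ∀ {n} → WGraph n → ℕ → Set
IsSingleVertexCoverNumber G N = SingleGood G N × (∀ M → SingleGood G M → N ≤ M)

-- The weighted K4: vertices x1..x4 = 0..3; edges x1x2 and x3x4 weight 2,
-- all other edges weight 5.  (The diagonal value is irrelevant: no loops.)
w₄ : Fin 4 → Fin 4 → ℕ
w₄ zero (suc zero) = 2
w₄ (suc zero) zero = 2
w₄ (suc (suc zero)) (suc (suc (suc zero))) = 2
w₄ (suc (suc (suc zero))) (suc (suc zero)) = 2
w₄ _ _ = 5

K₄w : WGraph 4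
K₄w = record { Adj = λ x y → x ≢ y ; weight = w₄ }

D94 : Dist 4
D94 zero = 9
D94 (suc zero) = 4
D94 _ = 0

module Submission where

-- The proof rests on one general fact: on a weighted graph with decidable
-- adjacency in which every edge has weight at least 2, reachability of a
-- target distribution is DECIDABLE.  Each move spends w ≥ 2 pebbles and
-- creates one, so the total strictly decreases; hence a distribution D can
-- make at most  total D  moves, and it suffices to search all move
-- sequences of that length in which each move is the canonical update
-- `move x y` (every actual pebbling step is pointwise equal to one).
--
-- For K₄w the decision procedure then settles both concrete claims: 13
-- pebbles on any vertex reach the all-ones distribution (e.g. from x₁ send
-- one pebble to each other vertex, spending 2 + 5 + 5 = 12), while
-- (9, 4, 0, 0) does not.  The last claim, γ ≠ N, is a general consequence
-- of having a bad distribution whose size is at least a single-vertex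
-- cover number; it is proved for arbitrary weighted graphs.

open import Defs
open import Data.Nat using (ℕ; zero; suc; _+_; _∸_; _≤_; _<_; _≤?_; s≤s)
open import Data.Nat.Properties
  using (+-assoc; +-comm; +-suc; +-cancelʳ-≡; +-monoʳ-≤; m+[n∸m]≡n; m∸n≤m;
         n<1+n; m+1+n≰m; ≤-refl; ≤-trans; module ≤-Reasoning)
open import Data.Fin using (Fin; zero; suc; _≟_)
open import Data.Fin.Properties using (any?; all?)
open import Data.Vec.Functional using (updateAt)
open import Data.Vec.Functional.Properties using (updateAt-updates; updateAt-minimal)
open import Data.Product using (∃₂; _×_; _,_)
open import Data.Sum using (_⊎_; inj₁; inj₂)
open import Function using (_∘_)
open import Relation.Nullary using (¬_; Dec; yes; no)
open import Relation.Nullary.Decidable using (map′; ¬?; _×-dec_; _⊎-dec_; from-yes; from-no)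
open import Relation.Binary.PropositionalEquality
open import Relation.Binary.Construct.Closure.ReflexiveTransitive using (Star; ε; _◅_)

_⊑_ : ∀ {n} → Dist n → Dist n → Set
T ⊑ D = ∀ v → T v ≤ D v

updateAt-resp : ∀ {n} {D D′ : Dist n} (v : Fin n) (f : ℕ → ℕ) →
                D ≗ D′ → updateAt D v f ≗ updateAt D′ v f
updateAt-resp zero    f eq zero    = cong f (eq zero)
updateAt-resp zero    f eq (suc u) = eq (suc u)
updateAt-resp (suc v) f eq zero    = eq zero
updateAt-resp (suc v) f eq (suc u) = updateAt-resp v f (eq ∘ suc) u

total-cong : ∀ {n} {D D′ : Dist n} → D ≗ D′ → total D ≡ total D′
total-cong {zero}  eq = refl
total-cong {suc n} eq = cong₂ _+_ (eq zero) (total-cong (eq ∘ suc))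

total-updateAt : ∀ {n} (D : Dist n) (v : Fin n) (f : ℕ → ℕ) →
                 total (updateAt D v f) + D v ≡ total D + f (D v)
total-updateAt D zero f = begin
  f a + t + a   ≡⟨ +-assoc (f a) t a ⟩
  f a + (t + a) ≡⟨ cong (f a +_) (+-comm t a) ⟩
  f a + (a + t) ≡⟨ +-comm (f a) (a + t) ⟩
  a + t + f a   ∎
  where
  open ≡-Reasoning
  a = D zero
  t = total (D ∘ suc)
total-updateAt D (suc v) f = begin
  a + t′ + D (suc v)   ≡⟨ +-assoc a t′ (D (suc v)) ⟩
  a + (t′ + D (suc v)) ≡⟨ cong (a +_) (total-updateAt (D ∘ suc) v f) ⟩
  a + (t + f (D (suc v))) ≡⟨ +-assoc a t _ ⟨
  a + t + f (D (suc v)) ∎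
  where
  open ≡-Reasoning
  a  = D zero
  t  = total (D ∘ suc)
  t′ = total (updateAt (D ∘ suc) v f)

total-add-one : ∀ {n} (D : Dist n) (v : Fin n) →
                total (updateAt D v (_+ 1)) ≡ suc (total D)
total-add-one D v = +-cancelʳ-≡ (D v) _ _ (begin
  total (updateAt D v (_+ 1)) + D v ≡⟨ total-updateAt D v (_+ 1) ⟩
  total D + (D v + 1)               ≡⟨ cong (total D +_) (+-comm (D v) 1) ⟩
  total D + suc (D v)               ≡⟨ +-suc (total D) (D v) ⟩
  suc (total D) + D v ∎)
  where open ≡-Reasoning

total-remove : ∀ {n} (D : Dist n) (v : Fin n) {w : ℕ} → w ≤ D v →
               total (updateAt D v (_∸ w)) + w ≡ total D
total-remove D v {w} w≤Dv = +-cancelʳ-≡ (D v ∸ w) _ _ (begin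
  total E + w + (D v ∸ w)   ≡⟨ +-assoc (total E) w _ ⟩
  total E + (w + (D v ∸ w)) ≡⟨ cong (total E +_) (m+[n∸m]≡n w≤Dv) ⟩
  total E + D v             ≡⟨ total-updateAt D v (_∸ w) ⟩
  total D + (D v ∸ w)       ∎)
  where
  open ≡-Reasoning
  E = updateAt D v (_∸ w)

module Moves {n : ℕ} (G : WGraph n) where

  move : Fin n → Fin n → Dist n → Dist n
  move x y D = updateAt (updateAt D x (_∸ weight G x y)) y (_+ 1)

  Legal : Dist n → Fin n → Fin n → Set
  Legal D x y = Adj G x y × x ≢ y × weight G x y ≤ D x

  module _ {x y : Fin n} (x≢y : x ≢ y) (D : Dist n) where

    move-source : move x y D x ≡ D x ∸ weight G x y
    move-source = trans (updateAt-minimal x y _ x≢y) (updateAt-updates x D)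

    move-target : move x y D y ≡ D y + 1
    move-target = trans (updateAt-updates y _)
                        (cong (_+ 1) (updateAt-minimal y x D (x≢y ∘ sym)))

    move-elsewhere : ∀ v → v ≢ x → v ≢ y → move x y D v ≡ D v
    move-elsewhere v v≢x v≢y =
      trans (updateAt-minimal v y _ v≢y) (updateAt-minimal v x D v≢x)

  legal⇒step : ∀ {D x y} → Legal D x y → Step G D (move x y D)
  legal⇒step {D} {x} {y} (adj , x≢y , w≤Dx) =
    x , y , adj , w≤Dx , move-source x≢y D , move-target x≢y D ,
    move-elsewhere x≢y D

  -- Conversely every pebbling step is legal and agrees pointwise with the
  -- canonical move.  (A step cannot be a loop: x would have to end with
  -- both D x ∸ w and D x + 1 pebbles.)
  step⇒legal : ∀ {D D₁} → Step G D D₁ →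
               ∃₂ λ x y → Legal D x y × D₁ ≗ move x y D
  step⇒legal {D} {D₁} (x , y , adj , w≤Dx , at-x , at-y , elsewhere) =
    x , y , (adj , x≢y , w≤Dx) , agree
    where
    x≢y : x ≢ y
    x≢y refl = m+1+n≰m (D x) (begin
      D x + 1             ≡⟨ trans (sym at-y) at-x ⟩
      D x ∸ weight G x x  ≤⟨ m∸n≤m (D x) (weight G x x) ⟩
      D x                 ∎)
      where open ≤-Reasoning

    agree : D₁ ≗ move x y D
    agree v with v ≟ x | v ≟ y
    ... | yes refl | _        = trans at-x (sym (move-source x≢y D))
    ... | no  _    | yes refl = trans at-y (sym (move-target x≢y D))
    ... | no  v≢x  | no  v≢y  =
      trans (elsewhere v v≢x v≢y) (sym (move-elsewhere x≢y D v v≢x v≢y))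

  total-move : ∀ {D x y} → Legal D x y → 2 ≤ weight G x y →
               total (move x y D) < total D
  total-move {D} {x} {y} (_ , _ , w≤Dx) 2≤w = begin-strict
    total (move x y D)         ≡⟨ total-add-one E y ⟩
    suc (total E)              <⟨ n<1+n (suc (total E)) ⟩
    2 + total E                ≡⟨ +-comm 2 (total E) ⟩
    total E + 2                ≤⟨ +-monoʳ-≤ (total E) 2≤w ⟩
    total E + weight G x y     ≡⟨ total-remove D x w≤Dx ⟩
    total D                    ∎
    where
    open ≤-Reasoning
    E = updateAt D x (_∸ weight G x y)

  data Reaches (T : Dist n) : ℕ → Dist n → Set where
    done : ∀ {k D} → T ⊑ D → Reaches T k D
    step : ∀ {k D x y} → Legal D x y → Reaches T k (move x y D) →
           Reaches T (suc k) D

  reaches-resp : ∀ {T k D D′} → D ≗ D′ → Reaches T k D → Reaches T k D′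
  reaches-resp eq (done T⊑D) = done λ v → subst (_ ≤_) (eq v) (T⊑D v)
  reaches-resp eq (step {x = x} {y} (adj , x≢y , w≤Dx) r) =
    step (adj , x≢y , subst (_ ≤_) (eq x) w≤Dx)
         (reaches-resp (updateAt-resp y (_+ 1)
                          (updateAt-resp x (_∸ weight G x y) eq)) r)

  reaches-sound : ∀ {T k D} → Reaches T k D → Reachable G D T
  reaches-sound (done {D = D} T⊑D) = D , ε , T⊑D
  reaches-sound (step legal r) with reaches-sound r
  ... | D″ , path , T⊑D″ = D″ , legal⇒step legal ◅ path , T⊑D″

  -- If every edge is heavy, a move sequence from D has at most total D
  -- moves, so Reaches with budget total D captures all of reachability.
  reaches-complete : (∀ {x y} → Adj G x y → 2 ≤ weight G x y) →
                     ∀ {T D D″} → Star (Step G) D D″ → T ⊑ D″ →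
                     ∀ {k} → total D ≤ k → Reaches T k D
  reaches-complete heavy ε T⊑D″ _ = done T⊑D″
  reaches-complete heavy {D = D} (st ◅ path) T⊑D″ bound
    with step⇒legal st
  ... | x , y , legal@(adj , _) , D₁≗move
    with ≤-trans (subst (_< total D) (sym (total-cong D₁≗move))
                        (total-move legal (heavy adj))) bound
  ... | s≤s bound′ =
    step legal (reaches-resp D₁≗move (reaches-complete heavy path T⊑D″ bound′))

  module Decision (adj? : ∀ x y → Dec (Adj G x y)) where

    legal? : ∀ D x y → Dec (Legal D x y)
    legal? D x y = adj? x y ×-dec ¬? (x ≟ y) ×-dec (weight G x y ≤? D x)

    ⊑? : (T D : Dist n) → Dec (T ⊑ D)
    ⊑? T D = all? λ v → T v ≤? D v

    reaches? : ∀ T k D → Dec (Reaches T k D)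
    reaches? T zero    D = map′ done (λ { (done T⊑D) → T⊑D }) (⊑? T D)
    reaches? T (suc k) D =
      map′ fromCases toCases
        (⊑? T D ⊎-dec any? λ x → any? λ y →
           legal? D x y ×-dec reaches? T k (move x y D))
      where
      fromCases : T ⊑ D ⊎ (∃₂ λ x y → Legal D x y × Reaches T k (move x y D)) →
                  Reaches T (suc k) D
      fromCases (inj₁ T⊑D)                 = done T⊑D
      fromCases (inj₂ (_ , _ , legal , r)) = step legal r

      toCases : Reaches T (suc k) D →
                T ⊑ D ⊎ (∃₂ λ x y → Legal D x y × Reaches T k (move x y D))
      toCases (done T⊑D)     = inj₁ T⊑D
      toCases (step legal r) = inj₂ (_ , _ , legal , r)

    reachable? : (∀ {x y} → Adj G x y → 2 ≤ weight G x y) →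
                 ∀ D T → Dec (Reachable G D T)
    reachable? heavy D T =
      map′ reaches-sound
           (λ { (_ , path , T⊑D″) → reaches-complete heavy path T⊑D″ ≤-refl })
           (reaches? T (total D) D)

-- If some distribution D with at least M pebbles cannot be covered although
-- M pebbles on any single vertex suffice, then γ(G) differs from the
-- single-vertex cover number N: γ = N ≤ M ≤ total D would cover D.
cover≢single : ∀ {n} (G : WGraph n) (D : Dist n) (M : ℕ) →
               SingleGood G M → M ≤ total D → ¬ Reachable G D ones →
               ∀ γ N → IsCoverPebblingNumber G γ →
               IsSingleVertexCoverNumber G N → γ ≢ N
cover≢single G D M single-M M≤D uncoverable γ .γ (coverγ , _) (_ , leastN) refl =
  uncoverable (coverγ D (≤-trans (leastN M single-M) M≤D))

w₄-heavy : ∀ x y → 2 ≤ w₄ x y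
w₄-heavy = from-yes (all? λ x → all? λ y → 2 ≤? w₄ x y)

K₄w-heavy : ∀ {x y} → Adj K₄w x y → 2 ≤ w₄ x y
K₄w-heavy {x} {y} _ = w₄-heavy x y

open Moves K₄w using (module Decision)
open Decision (λ x y → ¬? (x ≟ y)) using (reachable?)

coverable? : ∀ D → Dec (Reachable K₄w D ones)
coverable? D = reachable? K₄w-heavy D ones

thirteen-on-a-vertex : ∀ (v : Fin 4) → Reachable K₄w (single v 13) ones
thirteen-on-a-vertex zero                   = from-yes (coverable? (single zero 13))
thirteen-on-a-vertex (suc zero)             = from-yes (coverable? (single (suc zero) 13))
thirteen-on-a-vertex (suc (suc zero))       = from-yes (coverable? (single (suc (suc zero)) 13))
thirteen-on-a-vertex (suc (suc (suc zero))) = from-yes (coverable? (single (suc (suc (suc zero))) 13))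

nine-four-uncoverable : ¬ Reachable K₄w D94 ones
nine-four-uncoverable = from-no (coverable? D94)

mainTheorem6 :
    (∀ (v : Fin 4) → Reachable K₄w (single v 13) ones)
    × ¬ Reachable K₄w D94 ones
    × (∀ (γ N : ℕ) → IsCoverPebblingNumber K₄w γ → IsSingleVertexCoverNumber K₄w N → γ ≢ N)
mainTheorem6 =
  thirteen-on-a-vertex ,
  nine-four-uncoverable ,
  cover≢single K₄w D94 13 thirteen-on-a-vertex ≤-refl nine-four-uncoverable
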